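{- Let $T$ be a text of length $n$ whose last character is a sentinel that occurs nowhere else in $T$ and is lexicographically smallest. Let $1\le s\le e\le n$, $S:=T[s\ldots e]$, $i:=\mathit{ISA}[s]$ and $j:=\mathit{LF}[i]$. Then $(s,e)$ is a net occurrence if and only if $|S|=\ell(i)$ and $|S|\ge\ell(j)$.
   Context: $T_k=T[k\ldots n]$. The suffix array $\mathit{SA}$ lists starting positions of suffixes in lexicographic order; $\mathit{ISA}$ is its inverse ($\mathit{ISA}[k]=i$ iff $\mathit{SA}[i]=k$). $\mathit{LF}[i]=\mathit{ISA}[\mathit{SA}[i]-1]$ if $\mathit{SA}[i]>1$ and $\mathit{LF}[i]=1$ if $\mathit{SA}[i]=1$. $\mathit{LCP}[i]$ ($2\le i\le n$) is the length of the longest common prefix of $T_{\mathit{SA}[i-1]}$ and $T_{\mathit{SA}[i]}$, with $\mathit{LCP}[1]=\mathit{LCP}[n+1]=0$; $\ell(i)=\max(\mathit{LCP}[i],\mathit{LCP}[i+1])$ for $i\in[n]$. With $f(W)$ the number of occurrences of $W$ in $T$, an occurrence $(s,e)$ is a net occurrence if $f(T[s\ldots e])\ge 2$, $f(T[s-1\ldots e])=1$ and $f(T[s\ldots e+1])=1$, where the second condition is considered true when $s=1$ and the third when $e=n$. -}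

module Defs where

open import Data.Nat using (ℕ; zero; suc; _+_; _∸_; _<_; _≤_; _⊔_; _≤ᵇ_; _<ᵇ_; _≡ᵇ_)
open import Data.Bool using (Bool; true; false; if_then_else_; _∧_; _∨_)
open import Data.List using (List; []; _∷_; _++_; [_]; length; drop; take; filter; map; upTo)
open import Data.List.Relation.Unary.All using (All)
open import Data.Product using (∃₂; _×_)
open import Data.Sum using (_⊎_)
open import Relation.Binary.PropositionalEquality using (_≡_)
open import Relation.Nullary.Decidable using (Dec; yes; no)
open import Data.Bool.Properties using (T?)

-- Texts are lists over an integer alphabet ℕ (ordered by the usual order on ℕ).
-- Positions are 1-based: T[1..n] with n = length T.
Text : Set
Text = List ℕ

-- The last character is a sentinel: strictly smaller than every other character
-- (hence unique and lexicographically smallest).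
HasSentinel : Text → Set
HasSentinel T = ∃₂ λ (T' : Text) (c : ℕ) → (T ≡ T' ++ [ c ]) × All (c <_) T'

suf : Text → ℕ → Text
suf T k = drop (k ∸ 1) T

sub : Text → ℕ → ℕ → Text
sub T s e = take (suc e ∸ s) (drop (s ∸ 1) T)

positions : Text → List ℕ
positions T = map suc (upTo (length T))

isPrefix : List ℕ → List ℕ → Bool
isPrefix []       _        = true
isPrefix (_ ∷ _)  []       = false
isPrefix (x ∷ xs) (y ∷ ys) = (x ≡ᵇ y) ∧ isPrefix xs ys

lexLt : List ℕ → List ℕ → Bool
lexLt _        []       = false
lexLt []       (_ ∷ _)  = true
lexLt (x ∷ xs) (y ∷ ys) = (x <ᵇ y) ∨ ((x ≡ᵇ y) ∧ lexLt xs ys)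

count : (ℕ → Bool) → List ℕ → ℕ
count p xs = length (filter (λ k → T? (p k)) xs)

occ : Text → List ℕ → ℕ
occ T W = count (λ k → isPrefix W (suf T k)) (positions T)

ISA : Text → ℕ → ℕ
ISA T k = suc (count (λ k' → lexLt (suf T k') (suf T k)) (positions T))

-- SA[i] = the position k ∈ [1..n] with ISA[k] = i (the inverse of ISA); 0 if none.
findFirst : (ℕ → Bool) → List ℕ → ℕ
findFirst p []       = 0
findFirst p (k ∷ ks) = if p k then k else findFirst p ks

SA : Text → ℕ → ℕ
SA T i = findFirst (λ k → ISA T k ≡ᵇ i) (positions T)

LF : Text → ℕ → ℕ
LF T i = if 1 <ᵇ SA T i then ISA T (SA T i ∸ 1) else 1

lcp : List ℕ → List ℕ → ℕ
lcp (x ∷ xs) (y ∷ ys) = if x ≡ᵇ y then suc (lcp xs ys) else 0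
lcp _        _        = 0

-- LCP[i] for 2 ≤ i ≤ n, LCP[1] = LCP[n+1] = 0 (also 0 outside these ranges)
LCP : Text → ℕ → ℕ
LCP T i = if (2 ≤ᵇ i) ∧ (i ≤ᵇ length T)
          then lcp (suf T (SA T (i ∸ 1))) (suf T (SA T i))
          else 0

ℓ : Text → ℕ → ℕ
ℓ T i = LCP T i ⊔ LCP T (suc i)

NetOcc : Text → ℕ → ℕ → Set
NetOcc T s e =
  (2 ≤ occ T (sub T s e)) ×
  ((s ≡ 1) ⊎ (occ T (sub T (s ∸ 1) e) ≡ 1)) ×
  ((e ≡ length T) ⊎ (occ T (sub T s (suc e)) ≡ 1))

{-# OPTIONS --safe #-}
-- ℓ(ISA[p]) is the length of the longest prefix of T_p that occurs elsewhere in T: if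
-- T_a ≤ T_q ≤ T_b lexicographically then lcp(T_a, T_b) ≤ lcp(T_q, T_b), so the lcp of T_p with any
-- other suffix is bounded by the LCP entry between T_p and its suffix-array neighbour on that side,
-- and ℓ is the larger of the two entries. Hence the substring of length m starting at p occurs at
-- least twice iff m ≤ ℓ(ISA[p]), and exactly once iff ℓ(ISA[p]) < m. Applied to S, T[s..e+1] and
-- T[s-1..e], the three conditions of a net occurrence become |S| ≤ ℓ(i), ℓ(i) ≤ |S| (for e = n
-- because ℓ(i) ≤ |T_s|) and ℓ(ISA[s-1]) = ℓ(LF[i]) ≤ |S|. For s = 1 the sentinel makes T_n the
-- smallest suffix, so LF[i] = 1 and ℓ(1) ≤ |T_n| = 1.

module Submission where

open import Defs
open import Data.Bool using (Bool; true; false; T; if_then_else_; _∧_)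
open import Data.Bool.Properties using (T?; T-≡; T-∧; T-∨)
open import Data.Empty using (⊥-elim)
open import Data.Fin using (Fin; toℕ; fromℕ<; punchOut)
import Data.Fin.Properties as Fin
open import Data.List using (List; []; _∷_; _++_; [_]; length; drop; take; filter; map; upTo)
open import Data.List.Properties
  using (length-map; length-upTo; length-drop; length-++; filter-notAll; filter-some; filter-none)
open import Data.List.Membership.Propositional using (_∈_; lose)
open import Data.List.Membership.Propositional.Properties
  using (∈-map⁺; ∈-map⁻; ∈-upTo⁺; ∈-upTo⁻; ∈-filter⁺; ∈-filter⁻)
open import Data.List.Relation.Unary.Any using (here; there)
open import Data.List.Relation.Unary.All using (All; _∷_)
import Data.List.Relation.Unary.All as All
open import Data.List.Relation.Unary.Unique.Propositional using (Unique; _∷_)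
import Data.List.Relation.Unary.Unique.Propositional.Properties as Unique
open import Data.List.Relation.Binary.Pointwise using (Pointwise-≡⇒≡; ≡⇒Pointwise-≡)
open import Data.List.Relation.Binary.Lex.Core using (Lex; base; halt; this; next)
open import Data.List.Relation.Binary.Lex.Strict as Lex using (Lex-<; Lex-≤)
open import Data.List.Relation.Binary.Sublist.Heterogeneous using (Sublist)
open import Data.List.Relation.Binary.Sublist.Heterogeneous.Properties
  using (length-mono-≤; ⊆-filter-Sublist; fromPointwise; toPointwise)
open import Data.Nat
  using (ℕ; zero; suc; _∸_; _<_; _≤_; _⊔_; _<ᵇ_; _≤ᵇ_; _≡ᵇ_; z≤n; s≤s; _≟_; _≤?_; s≤s⁻¹)
open import Data.Nat.Properties
open import Data.Product using (∃; _×_; _,_; proj₁; proj₂)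
import Data.Product as Product
open import Data.Sum using (_⊎_; inj₁; inj₂; [_,_]′)
open import Data.Unit using (tt)
open import Function using (_∘_; flip)
open import Function.Bundles using (_⇔_; mk⇔; Equivalence)
open import Function.Definitions using (Injective)
import Function.Properties.Equivalence as ⇔
open import Relation.Binary.Definitions using (tri<; tri≈; tri>)
open import Relation.Binary.Structures using (IsStrictTotalOrder)
open import Relation.Binary.PropositionalEquality
  using (_≡_; _≢_; refl; sym; trans; cong; subst; subst₂; module ≡-Reasoning)
open import Relation.Nullary using (¬_; yes; no; contradiction)

open Equivalence using (to; from)

≤⊔⇒≤⊎≤ : ∀ {m x y} → m ≤ x ⊔ y → m ≤ x ⊎ m ≤ y
≤⊔⇒≤⊎≤ {m} {x} {y} m≤x⊔y with ⊔-sel x y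
... | inj₁ x⊔y≡x = inj₁ (subst (m ≤_) x⊔y≡x m≤x⊔y)
... | inj₂ x⊔y≡y = inj₂ (subst (m ≤_) x⊔y≡y m≤x⊔y)

<suc∸⇔≤∸ : ∀ {a b x} → a ≤ b → x < suc b ∸ a ⇔ x ≤ b ∸ a
<suc∸⇔≤∸ {a} {b} {x} a≤b rewrite +-∸-assoc 1 a≤b = mk⇔ s≤s⁻¹ s≤s

-- Counting and searching in lists

module _ (p : ℕ → Bool) where

  count-≥1 : ∀ {x xs} → x ∈ xs → T (p x) → 1 ≤ count p xs
  count-≥1 x∈xs px = filter-some (T? ∘ p) (lose x∈xs px)

  count<length : ∀ {x xs} → x ∈ xs → ¬ T (p x) → count p xs < length xs
  count<length {xs = xs} x∈xs ¬px = filter-notAll (T? ∘ p) xs (lose x∈xs ¬px)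

  count≡0 : ∀ {xs} → (∀ {x} → x ∈ xs → ¬ T (p x)) → count p xs ≡ 0
  count≡0 none = cong length (filter-none (T? ∘ p) (All.tabulate none))

  count-mono-< : ∀ q {x xs} → (∀ {y} → T (p y) → T (q y)) → x ∈ xs → ¬ T (p x) → T (q x) →
                 count p xs < count q xs
  count-mono-< q {x} {xs} p⇒q x∈xs ¬px qx = ≤∧≢⇒< (length-mono-≤ p⊆q) p≢q
    where
    xs⊆xs : Sublist _≡_ xs xs
    xs⊆xs = fromPointwise (≡⇒Pointwise-≡ refl)
    p⊆q : Sublist _≡_ (filter (T? ∘ p) xs) (filter (T? ∘ q) xs)
    p⊆q = ⊆-filter-Sublist (T? ∘ p) (T? ∘ q) (λ { refl → p⇒q }) xs⊆xs
    p≢q : count p xs ≢ count q xs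
    p≢q eq = ¬px (proj₂ (∈-filter⁻ (T? ∘ p) {xs = xs}
      (subst (x ∈_) (sym (Pointwise-≡⇒≡ (toPointwise eq p⊆q))) (∈-filter⁺ (T? ∘ q) x∈xs qx))))

distinct-members⇒2≤length : ∀ {x y : ℕ} {xs} → x ∈ xs → y ∈ xs → x ≢ y → 2 ≤ length xs
distinct-members⇒2≤length {xs = _ ∷ _ ∷ _} _ _ _ = s≤s (s≤s z≤n)
distinct-members⇒2≤length {xs = _ ∷ []} (here refl) (here refl) x≢y = contradiction refl x≢y

2≤length⇒other-member : ∀ {xs} → Unique xs → 2 ≤ length xs → ∀ x → ∃ λ y → y ∈ xs × y ≢ x
2≤length⇒other-member {a ∷ b ∷ _} ((a≢b ∷ _) ∷ _) _ x with a ≟ x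
... | yes refl = b , there (here refl) , a≢b ∘ sym
... | no a≢x = a , here refl , a≢x
2≤length⇒other-member {_ ∷ []} _ (s≤s ())

2≤count⇔ : ∀ p {x xs} → Unique xs → x ∈ xs → T (p x) →
           2 ≤ count p xs ⇔ (∃ λ y → y ∈ xs × y ≢ x × T (p y))
2≤count⇔ p {x} {xs} uniq x∈xs px = mk⇔ other twice
  where
  other : 2 ≤ count p xs → ∃ λ y → y ∈ xs × y ≢ x × T (p y)
  other 2≤c with y , y∈ , y≢x ← 2≤length⇒other-member (Unique.filter⁺ (T? ∘ p) uniq) 2≤c x
    = y , proj₁ (∈-filter⁻ (T? ∘ p) {xs = xs} y∈) , y≢x , proj₂ (∈-filter⁻ (T? ∘ p) {xs = xs} y∈)
  twice : (∃ λ y → y ∈ xs × y ≢ x × T (p y)) → 2 ≤ count p xs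
  twice (y , y∈ , y≢x , py) =
    distinct-members⇒2≤length (∈-filter⁺ (T? ∘ p) x∈xs px) (∈-filter⁺ (T? ∘ p) y∈ py) (y≢x ∘ sym)

findFirst-satisfies : ∀ p {x xs} → x ∈ xs → T (p x) → findFirst p xs ∈ xs × T (p (findFirst p xs))
findFirst-satisfies p {xs = y ∷ ys} x∈xs px with p y in py
... | true = here refl , subst T (sym py) tt
... | false with x∈xs
...   | here refl = ⊥-elim (subst T py px)
...   | there x∈ys = Product.map₁ there (findFirst-satisfies p x∈ys px)

-- Lexicographic order and longest common prefixes

≡ᵇ-refl : ∀ x → (x ≡ᵇ x) ≡ true
≡ᵇ-refl x = to T-≡ (≡⇒≡ᵇ x x refl)

≢⇒≡ᵇ≡false : ∀ {x y} → x ≢ y → (x ≡ᵇ y) ≡ false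
≢⇒≡ᵇ≡false {x} {y} x≢y with x ≡ᵇ y | ≡ᵇ⇒≡ x y
... | false | _ = refl
... | true | x≡y = contradiction (x≡y tt) x≢y

_<ₗₑₓ_ : List ℕ → List ℕ → Set
_<ₗₑₓ_ = Lex-< _≡_ _<_

_≤ₗₑₓ_ : List ℕ → List ℕ → Set
_≤ₗₑₓ_ = Lex-≤ _≡_ _<_

module <ₗₑₓ = IsStrictTotalOrder (Lex.<-isStrictTotalOrder <-isStrictTotalOrder)

lexLt⇒Lex : ∀ {P} xs ys → T (lexLt xs ys) → Lex P _≡_ _<_ xs ys
lexLt⇒Lex []       (_ ∷ _)  _ = halt
lexLt⇒Lex (x ∷ xs) (y ∷ ys) h with to T-∨ h
... | inj₁ x<y = this (<ᵇ⇒< x y x<y)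
... | inj₂ x≡y∧xs<ys with x≡y , xs<ys ← to T-∧ x≡y∧xs<ys =
  next (≡ᵇ⇒≡ x y x≡y) (lexLt⇒Lex xs ys xs<ys)

<ₗₑₓ⇒lexLt : ∀ {xs ys} → xs <ₗₑₓ ys → T (lexLt xs ys)
<ₗₑₓ⇒lexLt halt                      = tt
<ₗₑₓ⇒lexLt (this x<y)                = from T-∨ (inj₁ (<⇒<ᵇ x<y))
<ₗₑₓ⇒lexLt (next {x = x} refl xs<ys) = from T-∨ (inj₂ (from T-∧ (≡⇒≡ᵇ x x refl , <ₗₑₓ⇒lexLt xs<ys)))

lcp-∷ : ∀ x xs ys → lcp (x ∷ xs) (x ∷ ys) ≡ suc (lcp xs ys)
lcp-∷ x xs ys rewrite ≡ᵇ-refl x = refl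

lcp-≢ : ∀ {x y} xs ys → x ≢ y → lcp (x ∷ xs) (y ∷ ys) ≡ 0
lcp-≢ xs ys x≢y rewrite ≢⇒≡ᵇ≡false x≢y = refl

lcp-comm : ∀ xs ys → lcp xs ys ≡ lcp ys xs
lcp-comm []       []       = refl
lcp-comm []       (_ ∷ _)  = refl
lcp-comm (_ ∷ _)  []       = refl
lcp-comm (x ∷ xs) (y ∷ ys) with x ≟ y
... | yes refl rewrite lcp-∷ x xs ys | lcp-∷ x ys xs = cong suc (lcp-comm xs ys)
... | no x≢y   rewrite lcp-≢ xs ys x≢y | lcp-≢ ys xs (x≢y ∘ sym) = refl

lcp≤length : ∀ xs ys → lcp xs ys ≤ length xs
lcp≤length []       _        = z≤n
lcp≤length (_ ∷ _)  []       = z≤n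
lcp≤length (x ∷ xs) (y ∷ ys) with x ≟ y
... | yes refl rewrite lcp-∷ x xs ys = s≤s (lcp≤length xs ys)
... | no x≢y   rewrite lcp-≢ xs ys x≢y = z≤n

lcp-self : ∀ xs → lcp xs xs ≡ length xs
lcp-self []       = refl
lcp-self (x ∷ xs) rewrite lcp-∷ x xs xs = cong suc (lcp-self xs)

isPrefix-take⇔ : ∀ m xs ys → m ≤ length xs → T (isPrefix (take m xs) ys) ⇔ m ≤ lcp xs ys
isPrefix-take⇔ zero     _        _        _ = mk⇔ (λ _ → z≤n) (λ _ → tt)
isPrefix-take⇔ (suc m)  (_ ∷ _)  []       _ = mk⇔ (λ ()) (λ ())
isPrefix-take⇔ (suc m)  (x ∷ xs) (y ∷ ys) (s≤s m≤∣xs∣) with x ≟ y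
... | yes refl rewrite ≡ᵇ-refl x =
  mk⇔ (s≤s ∘ to ih) (from ih ∘ s≤s⁻¹)
  where
  ih : T (isPrefix (take m xs) ys) ⇔ m ≤ lcp xs ys
  ih = isPrefix-take⇔ m xs ys m≤∣xs∣
... | no x≢y rewrite ≢⇒≡ᵇ≡false x≢y = mk⇔ (λ ()) (λ ())

lcp-sorted : ∀ {xs ys zs} → xs ≤ₗₑₓ ys → ys ≤ₗₑₓ zs → lcp xs zs ≤ lcp xs ys × lcp xs zs ≤ lcp ys zs
lcp-sorted {[]} _ _ = z≤n , z≤n
lcp-sorted {x ∷ xs} {_ ∷ _} {_ ∷ zs} (this x<y) (this y<z)
  rewrite lcp-≢ xs zs (<⇒≢ (<-trans x<y y<z)) = z≤n , z≤n
lcp-sorted {x ∷ xs} {_ ∷ _} {_ ∷ zs} (this x<y) (next refl _)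
  rewrite lcp-≢ xs zs (<⇒≢ x<y) = z≤n , z≤n
lcp-sorted {x ∷ xs} {_ ∷ _} {_ ∷ zs} (next refl _) (this y<z)
  rewrite lcp-≢ xs zs (<⇒≢ y<z) = z≤n , z≤n
lcp-sorted {x ∷ xs} {_ ∷ ys} {_ ∷ zs} (next refl xs≤ys) (next refl ys≤zs)
  rewrite lcp-∷ x xs zs | lcp-∷ x xs ys | lcp-∷ x ys zs = Product.map s≤s s≤s (lcp-sorted xs≤ys ys≤zs)

-- Ranks in a strict total order on 1‥ n

injective⇒surjective : ∀ {n} (f : Fin n → Fin n) → Injective _≡_ _≡_ f → ∀ r → ∃ λ k → f k ≡ r
injective⇒surjective f f-inj r with Fin.any? (λ k → f k Fin.≟ r)
... | yes hit = hit
injective⇒surjective {suc n} f f-inj r | no miss = contradiction (Fin.injective⇒≤ g-inj) 1+n≰n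
  where
  r≢f : ∀ k → r ≢ f k
  r≢f k r≡fk = miss (k , sym r≡fk)
  g : Fin (suc n) → Fin n
  g k = punchOut (r≢f k)
  g-inj : Injective _≡_ _≡_ g
  g-inj eq = f-inj (Fin.punchOut-injective (r≢f _) (r≢f _) eq)

1‥_ : ℕ → List ℕ
1‥ n = map suc (upTo n)

∈-1‥⁺ : ∀ {n k} → 1 ≤ k → k ≤ n → k ∈ 1‥ n
∈-1‥⁺ {k = suc _} _ k≤n = ∈-map⁺ suc (∈-upTo⁺ k≤n)

∈-1‥⁻ : ∀ {n k} → k ∈ 1‥ n → 1 ≤ k × k ≤ n
∈-1‥⁻ k∈ with _ , i∈ , refl ← ∈-map⁻ suc k∈ = s≤s z≤n , ∈-upTo⁻ i∈

length-1‥ : ∀ n → length (1‥ n) ≡ n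
length-1‥ n = trans (length-map suc (upTo n)) (length-upTo n)

1‥-unique : ∀ n → Unique (1‥ n)
1‥-unique n = Unique.map⁺ suc-injective (Unique.upTo⁺ n)

module Ranking (n : ℕ) (_≺_ : ℕ → ℕ → Bool)
  (≺-irrefl : ∀ {a} → ¬ T (a ≺ a))
  (≺-trans : ∀ {a b c} → T (a ≺ b) → T (b ≺ c) → T (a ≺ c))
  (≺-connex : ∀ {a b} → a ∈ 1‥ n → b ∈ 1‥ n → a ≢ b → T (a ≺ b) ⊎ T (b ≺ a))
  where

  rank : ℕ → ℕ
  rank k = suc (count (_≺ k) (1‥ n))

  unrank : ℕ → ℕ
  unrank r = findFirst (λ k → rank k ≡ᵇ r) (1‥ n)

  rank≤n : ∀ {a} → a ∈ 1‥ n → rank a ≤ n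
  rank≤n {a} a∈ = subst (count (_≺ a) (1‥ n) <_) (length-1‥ n) (count<length (_≺ a) a∈ ≺-irrefl)

  rank-mono : ∀ {a b} → a ∈ 1‥ n → T (a ≺ b) → rank a < rank b
  rank-mono a∈ a≺b = s≤s (count-mono-< _ _ (λ x≺a → ≺-trans x≺a a≺b) a∈ ≺-irrefl a≺b)

  rank-injective : ∀ {a b} → a ∈ 1‥ n → b ∈ 1‥ n → rank a ≡ rank b → a ≡ b
  rank-injective {a} {b} a∈ b∈ ra≡rb with a ≟ b
  ... | yes a≡b = a≡b
  ... | no a≢b with ≺-connex a∈ b∈ a≢b
  ...   | inj₁ a≺b = contradiction ra≡rb (<⇒≢ (rank-mono a∈ a≺b))
  ...   | inj₂ b≺a = contradiction (sym ra≡rb) (<⇒≢ (rank-mono b∈ b≺a))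

  rank-reflects-< : ∀ {a b} → a ∈ 1‥ n → b ∈ 1‥ n → rank a < rank b → T (a ≺ b)
  rank-reflects-< {a} {b} a∈ b∈ ra<rb with a ≟ b
  ... | yes refl = contradiction ra<rb (<-irrefl refl)
  ... | no a≢b with ≺-connex a∈ b∈ a≢b
  ...   | inj₁ a≺b = a≺b
  ...   | inj₂ b≺a = contradiction (rank-mono b∈ b≺a) (<-asym ra<rb)

  private
    position : Fin n → ℕ
    position i = suc (toℕ i)

    position∈ : ∀ i → position i ∈ 1‥ n
    position∈ i = ∈-1‥⁺ (s≤s z≤n) (Fin.toℕ<n i)

    rankFin : Fin n → Fin n
    rankFin i = fromℕ< (rank≤n (position∈ i))

    rank-position : ∀ i → rank (position i) ≡ suc (toℕ (rankFin i))
    rank-position i = cong suc (sym (Fin.toℕ-fromℕ< _))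

    rankFin-injective : Injective _≡_ _≡_ rankFin
    rankFin-injective {i} {j} eq = Fin.toℕ-injective (suc-injective
      (rank-injective (position∈ i) (position∈ j)
        (trans (rank-position i) (trans (cong (suc ∘ toℕ) eq) (sym (rank-position j))))))

  rank-surjective : ∀ {r} → 1 ≤ r → r ≤ n → ∃ λ k → k ∈ 1‥ n × rank k ≡ r
  rank-surjective {suc r} _ r<n
    with i , rankFinᵢ≡r ← injective⇒surjective rankFin rankFin-injective (fromℕ< r<n) =
    position i , position∈ i ,
    trans (rank-position i) (cong suc (trans (cong toℕ rankFinᵢ≡r) (Fin.toℕ-fromℕ< r<n)))

  rank-unrank : ∀ {r} → 1 ≤ r → r ≤ n → unrank r ∈ 1‥ n × rank (unrank r) ≡ r
  rank-unrank {r} 1≤r r≤n with k , k∈ , rk≡r ← rank-surjective 1≤r r≤n =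
    Product.map₂ (≡ᵇ⇒≡ _ r) (findFirst-satisfies (λ k → rank k ≡ᵇ r) k∈ (≡⇒≡ᵇ _ r rk≡r))

  unrank-rank : ∀ {a} → a ∈ 1‥ n → unrank (rank a) ≡ a
  unrank-rank {a} a∈ = rank-injective (proj₁ unrank-spec) a∈ (proj₂ unrank-spec)
    where
    unrank-spec : unrank (rank a) ∈ 1‥ n × rank (unrank (rank a)) ≡ rank a
    unrank-spec = rank-unrank (s≤s z≤n) (rank≤n a∈)

-- Suffixes, the suffix array and the LCP array

drop-length-++ : ∀ (xs : List ℕ) {ys} → drop (length xs) (xs ++ ys) ≡ ys
drop-length-++ []       = refl
drop-length-++ (_ ∷ xs) = drop-length-++ xs

suffix≮sentinel : ∀ {c} xs d → All (c <_) xs → d ≤ length xs → ¬ (drop d (xs ++ [ c ]) <ₗₑₓ [ c ])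
suffix≮sentinel []       zero    _          _         (this c<c)    = <-irrefl refl c<c
suffix≮sentinel []       zero    _          _         (next _ (base ()))
suffix≮sentinel (_ ∷ _)  zero    (c<x ∷ _)  _         (this x<c)    = <-asym c<x x<c
suffix≮sentinel (_ ∷ _)  zero    (c<x ∷ _)  _         (next refl _) = <-irrefl refl c<x
suffix≮sentinel (_ ∷ xs) (suc d) (_ ∷ c<xs) (s≤s d≤∣xs∣) = suffix≮sentinel xs d c<xs d≤∣xs∣

sentinel-rank : ∀ Tx → HasSentinel Tx → ISA Tx (length Tx) ≡ 1
sentinel-rank _ (T' , c , refl , c<T') = cong suc (count≡0 _ λ {k} k∈ →
  suffix≮sentinel T' (k ∸ 1) c<T' (k-1≤∣T'∣ k∈) ∘ subst (suf Tx k <ₗₑₓ_) last-suffix ∘ lexLt⇒Lex _ _)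
  where
  Tx : Text
  Tx = T' ++ [ c ]
  n-1≡∣T'∣ : length Tx ∸ 1 ≡ length T'
  n-1≡∣T'∣ = trans (cong (_∸ 1) (length-++ T')) (m+n∸n≡m (length T') 1)
  last-suffix : suf Tx (length Tx) ≡ [ c ]
  last-suffix = trans (cong (λ d → drop d Tx) n-1≡∣T'∣) (drop-length-++ T')
  k-1≤∣T'∣ : ∀ {k} → k ∈ 1‥ length Tx → k ∸ 1 ≤ length T'
  k-1≤∣T'∣ k∈ = subst (_ ≤_) n-1≡∣T'∣ (∸-monoˡ-≤ 1 (proj₂ (∈-1‥⁻ k∈)))

module Suffixes (Tx : Text) where

  n : ℕ
  n = length Tx

  suf-injective : ∀ {a b} → a ∈ 1‥ n → b ∈ 1‥ n → suf Tx a ≡ suf Tx b → a ≡ b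
  suf-injective {suc a} {suc b} a∈ b∈ eq = cong suc (begin
    a                           ≡⟨ m∸[m∸n]≡n (<⇒≤ (proj₂ (∈-1‥⁻ a∈))) ⟨
    n ∸ (n ∸ a)                 ≡⟨ cong (n ∸_) (length-drop a Tx) ⟨
    n ∸ length (suf Tx (suc a)) ≡⟨ cong (λ xs → n ∸ length xs) eq ⟩
    n ∸ length (suf Tx (suc b)) ≡⟨ cong (n ∸_) (length-drop b Tx) ⟩
    n ∸ (n ∸ b)                 ≡⟨ m∸[m∸n]≡n (<⇒≤ (proj₂ (∈-1‥⁻ b∈))) ⟩
    b                           ∎)
    where open ≡-Reasoning
  suf-injective {zero}  a∈ _  _ = contradiction (proj₁ (∈-1‥⁻ a∈)) λ ()
  suf-injective {suc _} {zero} _ b∈ _ = contradiction (proj₁ (∈-1‥⁻ b∈)) λ ()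

  _≺_ : ℕ → ℕ → Bool
  a ≺ b = lexLt (suf Tx a) (suf Tx b)

  ≺-irrefl : ∀ {a} → ¬ T (a ≺ a)
  ≺-irrefl {a} = <ₗₑₓ.irrefl (≡⇒Pointwise-≡ refl) ∘ lexLt⇒Lex (suf Tx a) (suf Tx a)

  ≺-trans : ∀ {a b c} → T (a ≺ b) → T (b ≺ c) → T (a ≺ c)
  ≺-trans {a} {b} {c} a≺b b≺c =
    <ₗₑₓ⇒lexLt (<ₗₑₓ.trans (lexLt⇒Lex (suf Tx a) (suf Tx b) a≺b) (lexLt⇒Lex (suf Tx b) (suf Tx c) b≺c))

  ≺-connex : ∀ {a b} → a ∈ 1‥ n → b ∈ 1‥ n → a ≢ b → T (a ≺ b) ⊎ T (b ≺ a)
  ≺-connex {a} {b} a∈ b∈ a≢b with <ₗₑₓ.compare (suf Tx a) (suf Tx b)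
  ... | tri< a<b _ _ = inj₁ (<ₗₑₓ⇒lexLt a<b)
  ... | tri≈ _ a≈b _ = contradiction (suf-injective a∈ b∈ (Pointwise-≡⇒≡ a≈b)) a≢b
  ... | tri> _ _ b<a = inj₂ (<ₗₑₓ⇒lexLt b<a)

  -- positions Tx, ISA Tx and SA Tx are 1‥ n, rank and unrank by definition.
  open Ranking n _≺_ (λ {a} → ≺-irrefl {a}) (λ {a b c} → ≺-trans {a} {b} {c}) (λ {a b} → ≺-connex {a} {b})

  lcpAt : ℕ → ℕ → ℕ
  lcpAt a b = lcp (suf Tx a) (suf Tx b)

  ISA-≤⇒≤ₗₑₓ : ∀ {a b} → a ∈ 1‥ n → b ∈ 1‥ n → ISA Tx a ≤ ISA Tx b → suf Tx a ≤ₗₑₓ suf Tx b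
  ISA-≤⇒≤ₗₑₓ a∈ b∈ ra≤rb with m≤n⇒m<n∨m≡n ra≤rb
  ... | inj₁ ra<rb = lexLt⇒Lex _ _ (rank-reflects-< a∈ b∈ ra<rb)
  ... | inj₂ ra≡rb rewrite rank-injective a∈ b∈ ra≡rb = Lex.≤-reflexive _≡_ _<_ (≡⇒Pointwise-≡ refl)

  LF-ISA : ∀ {p} → p ∈ 1‥ n → LF Tx (ISA Tx p) ≡ (if 1 <ᵇ p then ISA Tx (p ∸ 1) else 1)
  LF-ISA p∈ = cong (λ q → if 1 <ᵇ q then ISA Tx (q ∸ 1) else 1) (unrank-rank p∈)

  record AdjacentPair (r : ℕ) : Set where
    field
      lower upper : ℕ
      lower∈ : lower ∈ 1‥ n
      upper∈ : upper ∈ 1‥ n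
      rank-lower : ISA Tx lower ≡ r ∸ 1
      rank-upper : ISA Tx upper ≡ r
      LCP≡lcpAt : LCP Tx r ≡ lcpAt lower upper

  adjacent : ∀ {r} → 2 ≤ r → r ≤ n → AdjacentPair r
  adjacent {r} 2≤r r≤n = record
    { lower = SA Tx (r ∸ 1) ; lower∈ = proj₁ lower-spec ; rank-lower = proj₂ lower-spec
    ; upper = SA Tx r       ; upper∈ = proj₁ upper-spec ; rank-upper = proj₂ upper-spec
    ; LCP≡lcpAt = LCP≡
    }
    where
    lower-spec : SA Tx (r ∸ 1) ∈ 1‥ n × ISA Tx (SA Tx (r ∸ 1)) ≡ r ∸ 1
    lower-spec = rank-unrank (∸-monoˡ-≤ 1 2≤r) (≤-trans (m∸n≤m r 1) r≤n)
    upper-spec : SA Tx r ∈ 1‥ n × ISA Tx (SA Tx r) ≡ r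
    upper-spec = rank-unrank (≤-trans (s≤s z≤n) 2≤r) r≤n
    LCP≡ : LCP Tx r ≡ lcpAt (SA Tx (r ∸ 1)) (SA Tx r)
    LCP≡ rewrite to T-≡ (from T-∧ (≤⇒≤ᵇ 2≤r , ≤⇒≤ᵇ r≤n)) = refl

  1≤LCP⇒adjacent : ∀ {r} → 1 ≤ LCP Tx r → AdjacentPair r
  1≤LCP⇒adjacent {r} 1≤LCP with (2 ≤ᵇ r) ∧ (r ≤ᵇ n) in inRange
  ... | true with 2≤r , r≤n ← to T-∧ (from T-≡ inRange) = adjacent (≤ᵇ⇒≤ 2 r 2≤r) (≤ᵇ⇒≤ r n r≤n)
  ... | false = contradiction 1≤LCP λ ()

  LCP-between : ∀ {a b r} → a ∈ 1‥ n → b ∈ 1‥ n → ISA Tx a < r → r ≤ ISA Tx b → lcpAt a b ≤ LCP Tx r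
  LCP-between {a} {b} {r} a∈ b∈ ra<r r≤rb = begin
    lcpAt a b         ≤⟨ proj₂ (lcp-sorted (ISA-≤⇒≤ₗₑₓ a∈ lower∈ ra≤rl) (ISA-≤⇒≤ₗₑₓ lower∈ b∈ rl≤rb)) ⟩
    lcpAt lower b     ≤⟨ proj₁ (lcp-sorted (ISA-≤⇒≤ₗₑₓ lower∈ upper∈ rl≤ru) (ISA-≤⇒≤ₗₑₓ upper∈ b∈ ru≤rb)) ⟩
    lcpAt lower upper ≡⟨ LCP≡lcpAt ⟨
    LCP Tx r          ∎
    where
    open AdjacentPair (adjacent (≤-trans (s≤s (s≤s z≤n)) ra<r) (≤-trans r≤rb (rank≤n b∈)))
    open ≤-Reasoning
    ra≤rl : ISA Tx a ≤ ISA Tx lower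
    ra≤rl = subst (ISA Tx a ≤_) (sym rank-lower) (<⇒≤pred ra<r)
    rl≤ru : ISA Tx lower ≤ ISA Tx upper
    rl≤ru = subst₂ _≤_ (sym rank-lower) (sym rank-upper) (m∸n≤m r 1)
    ru≤rb : ISA Tx upper ≤ ISA Tx b
    ru≤rb = subst (_≤ ISA Tx b) (sym rank-upper) r≤rb
    rl≤rb : ISA Tx lower ≤ ISA Tx b
    rl≤rb = ≤-trans rl≤ru ru≤rb

  lcpAt≤ℓ : ∀ {p k} → p ∈ 1‥ n → k ∈ 1‥ n → k ≢ p → lcpAt p k ≤ ℓ Tx (ISA Tx p)
  lcpAt≤ℓ {p} {k} p∈ k∈ k≢p with <-cmp (ISA Tx k) (ISA Tx p)
  ... | tri< rk<rp _ _ = ≤-trans (≤-reflexive (lcp-comm (suf Tx p) (suf Tx k)))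
                                 (≤-trans (LCP-between k∈ p∈ rk<rp ≤-refl) (m≤m⊔n _ _))
  ... | tri≈ _ rk≡rp _ = contradiction (rank-injective k∈ p∈ rk≡rp) k≢p
  ... | tri> _ _ rp<rk = ≤-trans (LCP-between p∈ k∈ ≤-refl rp<rk) (m≤n⊔m _ _)

  PrefixRecurs : ℕ → ℕ → Set
  PrefixRecurs p m = ∃ λ k → k ∈ 1‥ n × k ≢ p × m ≤ lcpAt p k

  ≤LCP⇒PrefixRecurs : ∀ {p m} → p ∈ 1‥ n → 1 ≤ m → m ≤ LCP Tx (ISA Tx p) → PrefixRecurs p m
  ≤LCP⇒PrefixRecurs {p} {m} p∈ 1≤m m≤LCP = lower , lower∈ , lower≢p , m≤lcp
    where
    open AdjacentPair (1≤LCP⇒adjacent {ISA Tx p} (≤-trans 1≤m m≤LCP))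
    upper≡p : upper ≡ p
    upper≡p = rank-injective upper∈ p∈ rank-upper
    lower≢p : lower ≢ p
    lower≢p lower≡p = 1+n≢n (trans (cong (ISA Tx) (sym lower≡p)) rank-lower)
    m≤lcp : m ≤ lcpAt p lower
    m≤lcp = begin
      m                 ≤⟨ m≤LCP ⟩
      LCP Tx (ISA Tx p) ≡⟨ LCP≡lcpAt ⟩
      lcpAt lower upper ≡⟨ cong (lcpAt lower) upper≡p ⟩
      lcpAt lower p     ≡⟨ lcp-comm (suf Tx lower) (suf Tx p) ⟩
      lcpAt p lower     ∎
      where open ≤-Reasoning

  ≤LCP-next⇒PrefixRecurs : ∀ {p m} → p ∈ 1‥ n → 1 ≤ m → m ≤ LCP Tx (suc (ISA Tx p)) → PrefixRecurs p m
  ≤LCP-next⇒PrefixRecurs {p} {m} p∈ 1≤m m≤LCP = upper , upper∈ , upper≢p , m≤lcp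
    where
    open AdjacentPair (1≤LCP⇒adjacent {suc (ISA Tx p)} (≤-trans 1≤m m≤LCP))
    lower≡p : lower ≡ p
    lower≡p = rank-injective lower∈ p∈ rank-lower
    upper≢p : upper ≢ p
    upper≢p upper≡p = 1+n≢n (trans (sym rank-upper) (cong (ISA Tx) upper≡p))
    m≤lcp : m ≤ lcpAt p upper
    m≤lcp = subst (m ≤_) (trans LCP≡lcpAt (cong (λ q → lcpAt q upper) lower≡p)) m≤LCP

  ≤ℓ⇒PrefixRecurs : ∀ {p m} → p ∈ 1‥ n → 1 ≤ m → m ≤ ℓ Tx (ISA Tx p) → PrefixRecurs p m
  ≤ℓ⇒PrefixRecurs p∈ 1≤m m≤ℓ = [ ≤LCP⇒PrefixRecurs p∈ 1≤m , ≤LCP-next⇒PrefixRecurs p∈ 1≤m ]′ (≤⊔⇒≤⊎≤ m≤ℓ)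

  ℓ≤length : ∀ {p} → p ∈ 1‥ n → ℓ Tx (ISA Tx p) ≤ length (suf Tx p)
  ℓ≤length {p} p∈ with 1 ≤? ℓ Tx (ISA Tx p)
  ... | no ℓ≱1 = ≤-trans (s≤s⁻¹ (≰⇒> ℓ≱1)) z≤n
  ... | yes 1≤ℓ with k , _ , _ , ℓ≤lcp ← ≤ℓ⇒PrefixRecurs p∈ 1≤ℓ ≤-refl =
    ≤-trans ℓ≤lcp (lcp≤length (suf Tx p) (suf Tx k))

  module _ {p m} (p∈ : p ∈ 1‥ n) (1≤m : 1 ≤ m) (m≤∣p∣ : m ≤ length (suf Tx p)) where

    private
      W : List ℕ
      W = take m (suf Tx p)

      occurs-at⇔ : ∀ k → T (isPrefix W (suf Tx k)) ⇔ m ≤ lcpAt p k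
      occurs-at⇔ k = isPrefix-take⇔ m (suf Tx p) (suf Tx k) m≤∣p∣

      occurs-at-p : T (isPrefix W (suf Tx p))
      occurs-at-p = from (occurs-at⇔ p) (subst (m ≤_) (sym (lcp-self (suf Tx p))) m≤∣p∣)

      2≤occ⇔PrefixRecurs : 2 ≤ occ Tx W ⇔ PrefixRecurs p m
      2≤occ⇔PrefixRecurs = mk⇔
        (λ 2≤occ → let k , k∈ , k≢p , at-k = to twice 2≤occ in k , k∈ , k≢p , to (occurs-at⇔ k) at-k)
        (λ (k , k∈ , k≢p , m≤lcp) → from twice (k , k∈ , k≢p , from (occurs-at⇔ k) m≤lcp))
        where
        twice : 2 ≤ occ Tx W ⇔ (∃ λ k → k ∈ 1‥ n × k ≢ p × T (isPrefix W (suf Tx k)))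
        twice = 2≤count⇔ _ (1‥-unique n) p∈ occurs-at-p

    2≤occ⇔≤ℓ : 2 ≤ occ Tx W ⇔ m ≤ ℓ Tx (ISA Tx p)
    2≤occ⇔≤ℓ = mk⇔
      (λ 2≤occ → let k , k∈ , k≢p , m≤lcp = to 2≤occ⇔PrefixRecurs 2≤occ
                 in ≤-trans m≤lcp (lcpAt≤ℓ p∈ k∈ k≢p))
      (from 2≤occ⇔PrefixRecurs ∘ ≤ℓ⇒PrefixRecurs p∈ 1≤m)

    occ≡1⇔ℓ< : occ Tx W ≡ 1 ⇔ ℓ Tx (ISA Tx p) < m
    occ≡1⇔ℓ< = mk⇔
      (λ occ≡1 → ≰⇒> (λ m≤ℓ → contradiction (subst (2 ≤_) occ≡1 (from 2≤occ⇔≤ℓ m≤ℓ)) λ { (s≤s ()) }))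
      (λ ℓ<m → ≤-antisym (s≤s⁻¹ (≰⇒> (<⇒≱ ℓ<m ∘ to 2≤occ⇔≤ℓ))) (count-≥1 _ p∈ occurs-at-p))

  substring-length : ∀ {s e} → 1 ≤ s → s ≤ e → e ≤ n → 1 ≤ suc e ∸ s × suc e ∸ s ≤ length (suf Tx s)
  substring-length {suc s'} {e} _ s≤e e≤n =
    m<n⇒0<n∸m s≤e , subst (e ∸ s' ≤_) (sym (length-drop s' Tx)) (∸-monoˡ-≤ s' e≤n)

  module _ {s e} (1≤s : 1 ≤ s) (s≤e : s ≤ e) (e≤n : e ≤ n) where

    private
      s∈ : s ∈ 1‥ n
      s∈ = ∈-1‥⁺ 1≤s (≤-trans s≤e e≤n)

      fits : 1 ≤ suc e ∸ s × suc e ∸ s ≤ length (suf Tx s)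
      fits = substring-length 1≤s s≤e e≤n

    repeated⇔ : 2 ≤ occ Tx (sub Tx s e) ⇔ suc e ∸ s ≤ ℓ Tx (ISA Tx s)
    repeated⇔ = 2≤occ⇔≤ℓ s∈ (proj₁ fits) (proj₂ fits)

    unique⇔ : occ Tx (sub Tx s e) ≡ 1 ⇔ ℓ Tx (ISA Tx s) < suc e ∸ s
    unique⇔ = occ≡1⇔ℓ< s∈ (proj₁ fits) (proj₂ fits)

  rightMaximal⇔ : ∀ {s e} → 1 ≤ s → s ≤ e → e ≤ n →
                  (e ≡ n ⊎ occ Tx (sub Tx s (suc e)) ≡ 1) ⇔ ℓ Tx (ISA Tx s) ≤ suc e ∸ s
  rightMaximal⇔ {suc s'} {e} 1≤s s≤e e≤n with e ≟ n
  ... | yes refl = mk⇔ (λ _ → subst (ℓ Tx (ISA Tx (suc s')) ≤_) (length-drop s' Tx) (ℓ≤length (∈-1‥⁺ 1≤s s≤e)))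
                       (λ _ → inj₁ refl)
  ... | no e≢n = mk⇔ [ flip contradiction e≢n , to extended ]′ (inj₂ ∘ from extended)
    where
    extended : occ Tx (sub Tx (suc s') (suc e)) ≡ 1 ⇔ ℓ Tx (ISA Tx (suc s')) ≤ suc e ∸ suc s'
    extended = ⇔.trans (unique⇔ {suc s'} {suc e} 1≤s (m≤n⇒m≤1+n s≤e) (≤∧≢⇒< e≤n e≢n)) (<suc∸⇔≤∸ {a = suc s'} (m≤n⇒m≤1+n s≤e))

  ℓ₁≤1 : HasSentinel Tx → 1 ≤ n → ℓ Tx 1 ≤ 1
  ℓ₁≤1 sentinel 1≤n = begin
    ℓ Tx 1            ≡⟨ cong (ℓ Tx) (sentinel-rank Tx sentinel) ⟨
    ℓ Tx (ISA Tx n)   ≤⟨ ℓ≤length (∈-1‥⁺ 1≤n ≤-refl) ⟩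
    length (suf Tx n) ≡⟨ length-drop (n ∸ 1) Tx ⟩
    n ∸ (n ∸ 1)       ≡⟨ m∸[m∸n]≡n 1≤n ⟩
    1                 ∎
    where open ≤-Reasoning

  leftMaximal⇔ℓ-previous : HasSentinel Tx → ∀ {s e} → 1 ≤ s → s ≤ e → e ≤ n →
    (s ≡ 1 ⊎ occ Tx (sub Tx (s ∸ 1) e) ≡ 1) ⇔ ℓ Tx (if 1 <ᵇ s then ISA Tx (s ∸ 1) else 1) ≤ suc e ∸ s
  leftMaximal⇔ℓ-previous sentinel {1} 1≤s s≤e e≤n =
    mk⇔ (λ _ → ≤-trans (ℓ₁≤1 sentinel (≤-trans s≤e e≤n)) s≤e) (λ _ → inj₁ refl)
  leftMaximal⇔ℓ-previous sentinel {suc (suc s')} {e} 1≤s s≤e e≤n =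
    mk⇔ [ (λ ()) , to extended ]′ (inj₂ ∘ from extended)
    where
    extended : occ Tx (sub Tx (suc s') e) ≡ 1 ⇔ ℓ Tx (ISA Tx (suc s')) ≤ e ∸ suc s'
    extended = ⇔.trans (unique⇔ {suc s'} {e} (s≤s z≤n) (<⇒≤ s≤e) e≤n) (<suc∸⇔≤∸ {a = suc s'} (<⇒≤ s≤e))

  leftMaximal⇔ : HasSentinel Tx → ∀ {s e} → 1 ≤ s → s ≤ e → e ≤ n →
                 (s ≡ 1 ⊎ occ Tx (sub Tx (s ∸ 1) e) ≡ 1) ⇔ ℓ Tx (LF Tx (ISA Tx s)) ≤ suc e ∸ s
  leftMaximal⇔ sentinel {s} {e} 1≤s s≤e e≤n =
    subst (λ j → (s ≡ 1 ⊎ occ Tx (sub Tx (s ∸ 1) e) ≡ 1) ⇔ ℓ Tx j ≤ suc e ∸ s)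
          (sym (LF-ISA (∈-1‥⁺ 1≤s (≤-trans s≤e e≤n))))
          (leftMaximal⇔ℓ-previous sentinel 1≤s s≤e e≤n)

theorem15 : (T : Text) → HasSentinel T →
    (s e : ℕ) → 1 ≤ s → s ≤ e → e ≤ length T →
    NetOcc T s e ⇔ ((suc e ∸ s ≡ ℓ T (ISA T s)) × (ℓ T (LF T (ISA T s)) ≤ suc e ∸ s))
theorem15 Tx sentinel s e 1≤s s≤e e≤n = mk⇔
  (λ (rep , left , right) → ≤-antisym (to repeated rep) (to rightMax right) , to leftMax left)
  (λ (m≡ℓ , ℓ′≤m) → from repeated (≤-reflexive m≡ℓ) , from leftMax ℓ′≤m , from rightMax (≤-reflexive (sym m≡ℓ)))
  where
  open Suffixes Tx
  repeated : 2 ≤ occ Tx (sub Tx s e) ⇔ suc e ∸ s ≤ ℓ Tx (ISA Tx s)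
  repeated = repeated⇔ 1≤s s≤e e≤n
  leftMax : (s ≡ 1 ⊎ occ Tx (sub Tx (s ∸ 1) e) ≡ 1) ⇔ ℓ Tx (LF Tx (ISA Tx s)) ≤ suc e ∸ s
  leftMax = leftMaximal⇔ sentinel 1≤s s≤e e≤n
  rightMax : (e ≡ length Tx ⊎ occ Tx (sub Tx s (suc e)) ≡ 1) ⇔ ℓ Tx (ISA Tx s) ≤ suc e ∸ s
  rightMax = rightMaximal⇔ 1≤s s≤e e≤n
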